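{- For every $n\ge1$, $$\sum_{F\in\mathcal{F}_n^2}x^{\mathrm{risB}(F)}=\frac{(3n)!}{3^n\,n!}\sum_{\sigma\in S_n}x^{\mathrm{ris}(\sigma)},$$ where $\mathcal{F}_n^2$ is the set of forests of $n$ binary shrubs with label set $\{1,\ldots,3n\}$, $\mathrm{risB}(F)=|\{i\in\{1,\dots,n-1\}:F_i<_B F_{i+1}\}|$ for $F=(F_1,\dots,F_n)$, $S_n$ is the symmetric group, and $\mathrm{ris}(\sigma)=|\{i:\sigma_i<\sigma_{i+1}\}|$.
   Context: A binary shrub is a root with an ordered pair of children (left, right), labeled by distinct positive integers with the root's label smaller than both children's labels. A forest of $n$ binary shrubs with label set $\{1,\ldots,3n\}$ is an ordered sequence of $n$ binary shrubs whose labels together are exactly $\{1,\ldots,3n\}$, each used once. $F<_B G$ means the root label of $F$ is less than the root label of $G$. -}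

module Defs where

open import Data.Nat using (ℕ; zero; suc; _+_; _*_; _<ᵇ_)
open import Data.Fin as Fin using (Fin; toℕ; _≟_)
open import Data.Bool using (if_then_else_)
open import Data.List using (List; []; _∷_; map; concatMap; filter; allFin; concat)
open import Data.List.Relation.Unary.All using (All; all?)
open import Data.List.Relation.Unary.Any using (Any; any?)
open import Data.List.Relation.Unary.Unique.Propositional using (Unique)
open import Data.Product using (_×_; _,_; proj₁; proj₂)
open import Data.Vec as Vec using (Vec; []; _∷_; toList)
open import Relation.Binary.PropositionalEquality using (_≡_)
open import Relation.Nullary.Decidable using (Dec; _×-dec_)
import Data.List.Relation.Unary.Unique.DecPropositional as UDec

-- Label convention: a label in Fin m stands for the integer (toℕ i + 1) ∈ {1,…,m};
-- this shift preserves the order, which is all that matters.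

allVecs : {A : Set} → List A → (k : ℕ) → List (Vec A k)
allVecs xs zero    = [] ∷ []
allVecs xs (suc k) = concatMap (λ x → map (x ∷_) (allVecs xs k)) xs

ascents : List ℕ → ℕ
ascents (a ∷ b ∷ t) = (if a <ᵇ b then 1 else 0) + ascents (b ∷ t)
ascents _           = 0

IsPerm : (n : ℕ) → Vec (Fin n) n → Set
IsPerm n σ = Unique (toList σ) × All (λ ℓ → Any (ℓ ≡_) (toList σ)) (allFin n)

isPerm? : (n : ℕ) → (σ : Vec (Fin n) n) → Dec (IsPerm n σ)
isPerm? n σ = UDec.unique? _≟_ (toList σ)
  ×-dec all? (λ ℓ → any? (ℓ ≟_) (toList σ)) (allFin n)

perms : (n : ℕ) → List (Vec (Fin n) n)
perms n = filter (isPerm? n) (allVecs (allFin n) n)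

ris : {n : ℕ} → Vec (Fin n) n → ℕ
ris σ = ascents (map toℕ (toList σ))

-- Binary shrubs with labels in Fin m: (root, left child, right child)
-- with root < left and root < right.

Shrub : ℕ → Set
Shrub m = Fin m × Fin m × Fin m

root : {m : ℕ} → Shrub m → Fin m
root = proj₁

shrubLabels : {m : ℕ} → Shrub m → List (Fin m)
shrubLabels (r , l , ρ) = r ∷ l ∷ ρ ∷ []

IsShrub : {m : ℕ} → Shrub m → Set
IsShrub (r , l , ρ) = (r Fin.< l) × (r Fin.< ρ)

isShrub? : {m : ℕ} → (s : Shrub m) → Dec (IsShrub s)
isShrub? (r , l , ρ) = (r Fin.<? l) ×-dec (r Fin.<? ρ)

forestLabels : {m k : ℕ} → Vec (Shrub m) k → List (Fin m)
forestLabels F = concat (map shrubLabels (toList F))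

IsForest : (n : ℕ) → Vec (Shrub (3 * n)) n → Set
IsForest n F = All IsShrub (toList F)
  × Unique (forestLabels F)
  × All (λ ℓ → Any (ℓ ≡_) (forestLabels F)) (allFin (3 * n))

isForest? : (n : ℕ) → (F : Vec (Shrub (3 * n)) n) → Dec (IsForest n F)
isForest? n F = all? isShrub? (toList F)
  ×-dec UDec.unique? _≟_ (forestLabels F)
  ×-dec all? (λ ℓ → any? (ℓ ≟_) (forestLabels F)) (allFin (3 * n))

allShrubs : (m : ℕ) → List (Shrub m)
allShrubs m = concatMap (λ r → concatMap (λ l → map (λ ρ → r , l , ρ) (allFin m)) (allFin m)) (allFin m)

forests : (n : ℕ) → List (Vec (Shrub (3 * n)) n)
forests n = filter (isForest? n) (allVecs (allShrubs (3 * n)) n)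

risB : {m k : ℕ} → Vec (Shrub m) k → ℕ
risB F = ascents (map (λ s → toℕ (root s)) (toList F))

module Submission where

-- Sorting the shrubs of a forest by their roots writes it uniquely as an increasing forest
-- (roots increasing from left to right) rearranged by a permutation σ, and risB of the
-- rearranged forest is ris σ. So the left-hand sum is the number of increasing forests times
-- Σ_σ x^ris(σ). In an increasing forest on 3k labels the first root must be the least label and
-- its children are any two of the other 3k − 1 labels, which gives ∏_{j<k} (3j+2)(3j+1) =
-- (3k)! / (3^k k!) increasing forests.

open import Defs
open import Data.Bool using (if_then_else_)
open import Data.Empty using (⊥-elim)
open import Data.Fin as Fin using (Fin; zero; suc; toℕ; _≟_)
import Data.Fin.Properties as Finₚ
open import Data.List as List
  using (List; []; _∷_; _++_; map; filter; length; concat; concatMap; allFin; cartesianProduct)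
import Data.List.Properties as Listₚ
import Data.List.Sort as Sort
open import Data.List.Membership.Propositional using (_∈_; find; lose)
open import Data.List.Membership.Propositional.Properties
import Data.List.Membership.DecPropositional as DecMembership
open import Data.List.Membership.Propositional.Properties.WithK using (unique∧set⇒bag)
open import Data.List.Relation.Binary.BagAndSetEquality using (∼bag⇒↭)
open import Data.List.Relation.Binary.Permutation.Propositional as ↭ using (_↭_; ↭-sym)
import Data.List.Relation.Binary.Permutation.Propositional.Properties as ↭ₚ
import Data.List.Relation.Binary.Permutation.Setoid.Properties as ↭ₛ
open import Data.List.Relation.Unary.All as All using (All; []; _∷_; all?)
import Data.List.Relation.Unary.All.Properties as Allₚ
open import Data.List.Relation.Unary.AllPairs as AllPairs using (AllPairs; []; _∷_)
open import Data.List.Relation.Unary.Any using (here; there)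
open import Data.List.Relation.Unary.Unique.Propositional using (Unique)
import Data.List.Relation.Unary.Linked.Properties as Linkedₚ
import Data.List.Relation.Unary.Unique.Propositional.Properties as Uniqueₚ
import Data.List.Relation.Unary.Unique.DecPropositional as UniqueDec
open import Data.Nat as ℕ using (ℕ; zero; suc; _+_; _*_; _^_; _≤_; _<_; _<?_; s≤s)
open import Data.Nat.Base using (_!)
import Data.Nat.Properties as ℕₚ
open import Data.Nat.ListAction using (sum)
open import Data.Nat.ListAction.Properties using (sum-++; sum-↭)
open import Data.Nat.Tactic.RingSolver using (solve-∀)
open import Data.Product using (∃; _×_; _,_; proj₁; proj₂)
open import Data.Vec as Vec using (Vec; []; _∷_; toList; lookup)
import Data.Vec.Membership.Propositional.Properties as Vec∈
import Data.Vec.Properties as Vecₚ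
open import Function using (_∘_)
open import Function.Bundles using (_⇔_; mk⇔)
open import Relation.Binary.Definitions using (DecidableEquality; Irreflexive; Asymmetric; tri<; tri≈; tri>)
import Relation.Binary.Construct.On as On
open import Relation.Binary.PropositionalEquality
open import Relation.Nullary using (¬_; Dec; yes; no; ¬?)
open import Relation.Nullary.Decidable using (_×-dec_; does-⇔)
open import Relation.Unary using (Decidable)

private variable
  A B : Set
  k m n : ℕ

unique∧set⇒↭ : {xs ys : List A} → Unique xs → Unique ys →
  (∀ {z} → z ∈ xs → z ∈ ys) → (∀ {z} → z ∈ ys → z ∈ xs) → xs ↭ ys
unique∧set⇒↭ u v f g = ∼bag⇒↭ (unique∧set⇒bag u v (mk⇔ f g))

unique-resp-↭ : {xs ys : List A} → xs ↭ ys → Unique xs → Unique ys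
unique-resp-↭ {A = A} p = ↭ₛ.Unique-resp-↭ (setoid A) (↭.↭⇒↭ₛ p)

unique-map-injectiveOn : {f : A → B} {xs : List A} → Unique xs →
  (∀ {a b} → a ∈ xs → b ∈ xs → f a ≡ f b → a ≡ b) → Unique (map f xs)
unique-map-injectiveOn [] inj = []
unique-map-injectiveOn (x∉xs ∷ u) inj =
  Allₚ.map⁺ (All.tabulate λ y∈ e → All.lookup x∉xs y∈ (inj (here refl) (there y∈) e))
  ∷ unique-map-injectiveOn u (λ a∈ b∈ → inj (there a∈) (there b∈))

map-bijectiveOn⇒↭ : {f : A → B} {xs : List A} {ys : List B} → Unique xs → Unique ys →
  (∀ {a b} → a ∈ xs → b ∈ xs → f a ≡ f b → a ≡ b) →
  (∀ {a} → a ∈ xs → f a ∈ ys) →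
  (∀ {b} → b ∈ ys → ∃ λ a → a ∈ xs × f a ≡ b) →
  map f xs ↭ ys
map-bijectiveOn⇒↭ {f = f} u v inj into onto = unique∧set⇒↭ (unique-map-injectiveOn u inj) v
  (λ z∈ → let (a , a∈ , e) = ∈-map⁻ f z∈ in subst (_∈ _) (sym e) (into a∈))
  (λ z∈ → let (a , a∈ , e) = onto z∈ in subst (_∈ _) e (∈-map⁺ f a∈))

unique-concatMap : {g : A → List B} {xs : List A} → Unique xs → (∀ x → Unique (g x)) →
  (∀ {x y z} → z ∈ g x → z ∈ g y → x ≡ y) → Unique (concatMap g xs)
unique-concatMap [] ug disjoint = []
unique-concatMap {g = g} {x ∷ xs} (x∉xs ∷ u) ug disjoint =
  Uniqueₚ.++⁺ (ug x) (unique-concatMap u ug disjoint) apart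
  where
  apart : ∀ {z} → ¬ (z ∈ g x × z ∈ concatMap g xs)
  apart (z∈ , z∈′) with find (∈-concatMap⁻ g {xs = xs} z∈′)
  ... | y , y∈ , z∈y = All.lookup x∉xs y∈ (disjoint z∈ z∈y)

strictlySorted-unique : {_≺_ : A → A → Set} → Irreflexive _≡_ _≺_ → Asymmetric _≺_ →
  {xs ys : List A} → AllPairs _≺_ xs → AllPairs _≺_ ys →
  (∀ {z} → z ∈ xs → z ∈ ys) → (∀ {z} → z ∈ ys → z ∈ xs) → xs ≡ ys
strictlySorted-unique irr asym {[]} {[]} _ _ f g = refl
strictlySorted-unique irr asym {[]} {y ∷ ys} _ _ f g with () ← g (here refl)
strictlySorted-unique irr asym {x ∷ xs} {[]} _ _ f g with () ← f (here refl)
strictlySorted-unique irr asym {x ∷ xs} {y ∷ ys} (x≺xs ∷ sx) (y≺ys ∷ sy) f g =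
  cong₂ _∷_ x≡y (strictlySorted-unique irr asym sx sy f′ g′)
  where
  x≡y : x ≡ y
  x≡y with f (here refl) | g (here refl)
  ... | here e      | _           = e
  ... | there x∈ys  | here e      = ⊥-elim (irr e (All.lookup y≺ys x∈ys))
  ... | there x∈ys  | there y∈xs  = ⊥-elim (asym (All.lookup y≺ys x∈ys) (All.lookup x≺xs y∈xs))
  f′ : ∀ {z} → z ∈ xs → z ∈ ys
  f′ z∈ with f (there z∈)
  ... | here refl = ⊥-elim (irr x≡y (All.lookup x≺xs z∈))
  ... | there z∈′ = z∈′
  g′ : ∀ {z} → z ∈ ys → z ∈ xs
  g′ z∈ with g (there z∈)
  ... | here refl = ⊥-elim (irr (sym x≡y) (All.lookup y≺ys z∈))
  ... | there z∈′ = z∈′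

count : {P : A → Set} → Decidable P → List A → ℕ
count P? xs = length (filter P? xs)

𝟙 : {P : Set} → Dec P → ℕ
𝟙 (yes _) = 1
𝟙 (no _)  = 0

module _ {P : A → Set} (P? : Decidable P) where

  count-++ : (xs ys : List A) → count P? (xs ++ ys) ≡ count P? xs + count P? ys
  count-++ xs ys = trans (cong length (Listₚ.filter-++ P? xs ys)) (Listₚ.length-++ (filter P? xs))

  count-none : (xs : List A) → (∀ {x} → x ∈ xs → ¬ P x) → count P? xs ≡ 0
  count-none xs ¬P = cong length (Listₚ.filter-none P? (All.tabulate ¬P))

  count-cong : {Q : A → Set} (Q? : Decidable Q) (xs : List A) →
    (∀ {x} → x ∈ xs → P x → Q x) → (∀ {x} → x ∈ xs → Q x → P x) → count P? xs ≡ count Q? xs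
  count-cong Q? [] f g = refl
  count-cong Q? (x ∷ xs) f g with P? x | Q? x
  ... | yes p | yes q = cong suc (count-cong Q? xs (f ∘ there) (g ∘ there))
  ... | yes p | no ¬q = ⊥-elim (¬q (f (here refl) p))
  ... | no ¬p | yes q = ⊥-elim (¬p (g (here refl) q))
  ... | no ¬p | no ¬q = count-cong Q? xs (f ∘ there) (g ∘ there)

  count-map : (f : B → A) (xs : List B) → count P? (map f xs) ≡ count (P? ∘ f) xs
  count-map f [] = refl
  count-map f (x ∷ xs) with P? (f x)
  ... | yes _ = cong suc (count-map f xs)
  ... | no _  = count-map f xs

  count-concatMap : {Q : B → Set} (Q? : Decidable Q) (g : B → List A) (c : ℕ) (xs : List B) →
    (∀ {x} → x ∈ xs → count P? (g x) ≡ 𝟙 (Q? x) * c) → count P? (concatMap g xs) ≡ count Q? xs * c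
  count-concatMap Q? g c [] h = refl
  count-concatMap Q? g c (x ∷ xs) h with Q? x | h (here refl)
  ... | yes _ | block = trans (count-++ (g x) _)
    (cong₂ _+_ (trans block (ℕₚ.+-identityʳ c)) (count-concatMap Q? g c xs (h ∘ there)))
  ... | no _  | block = trans (count-++ (g x) _)
    (cong₂ _+_ block (count-concatMap Q? g c xs (h ∘ there)))

sum-map-const : (c : ℕ) (xs : List A) → sum (map (λ _ → c) xs) ≡ length xs * c
sum-map-const c []       = refl
sum-map-const c (_ ∷ xs) = cong (c +_) (sum-map-const c xs)

sum-cartesianProduct : (f : A → ℕ) (xs : List A) (ys : List B) →
  sum (map (f ∘ proj₁) (cartesianProduct xs ys)) ≡ length ys * sum (map f xs)
sum-cartesianProduct f [] ys = sym (ℕₚ.*-zeroʳ (length ys))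
sum-cartesianProduct f (x ∷ xs) ys = begin
    sum (map (f ∘ proj₁) (map (x ,_) ys ++ cartesianProduct xs ys))
  ≡⟨ cong sum (Listₚ.map-++ (f ∘ proj₁) (map (x ,_) ys) _) ⟩
    sum (map (f ∘ proj₁) (map (x ,_) ys) ++ map (f ∘ proj₁) (cartesianProduct xs ys))
  ≡⟨ sum-++ (map (f ∘ proj₁) (map (x ,_) ys)) _ ⟩
    sum (map (f ∘ proj₁) (map (x ,_) ys)) + sum (map (f ∘ proj₁) (cartesianProduct xs ys))
  ≡⟨ cong₂ _+_ (trans (cong sum (sym (Listₚ.map-∘ ys))) (sum-map-const (f x) ys))
               (sum-cartesianProduct f xs ys) ⟩
    length ys * f x + length ys * sum (map f xs)
  ≡⟨ ℕₚ.*-distribˡ-+ (length ys) (f x) _ ⟨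
    length ys * sum (map f (x ∷ xs)) ∎
  where open ≡-Reasoning

module DecidableLists {A : Set} (_≟_ : DecidableEquality A) where

  open DecMembership _≟_ using (_∈?_)

  count-∈ : {T xs : List A} → Unique T → Unique xs → (∀ {z} → z ∈ T → z ∈ xs) →
    count (_∈? T) xs ≡ length T
  count-∈ {T} {xs} uT uxs T⊆xs = ↭ₚ.↭-length (unique∧set⇒↭ (Uniqueₚ.filter⁺ (_∈? T) uxs) uT
    (λ z∈ → proj₂ (∈-filter⁻ (_∈? T) {xs = xs} z∈)) (λ z∈ → ∈-filter⁺ (_∈? T) (T⊆xs z∈) z∈))

  remove : A → List A → List A
  remove x = filter (λ y → ¬? (y ≟ x))

  ∈-remove⁺ : ∀ {x y xs} → y ∈ xs → ¬ y ≡ x → y ∈ remove x xs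
  ∈-remove⁺ = ∈-filter⁺ (λ z → ¬? (z ≟ _))

  ∈-remove⁻ : ∀ {x y xs} → y ∈ remove x xs → y ∈ xs × ¬ y ≡ x
  ∈-remove⁻ = ∈-filter⁻ (λ z → ¬? (z ≟ _))

  remove-unique : ∀ {x xs} → Unique xs → Unique (remove x xs)
  remove-unique = Uniqueₚ.filter⁺ (λ z → ¬? (z ≟ _))

  length-remove : ∀ {x} (xs : List A) → Unique xs → x ∈ xs → suc (length (remove x xs)) ≡ length xs
  length-remove (y ∷ ys) (y∉ys ∷ u) (here refl) with y ≟ y
  ... | yes _ = cong (suc ∘ length)
    (Listₚ.filter-all (λ z → ¬? (z ≟ y)) (All.map ≢-sym y∉ys))
  ... | no y≢y = ⊥-elim (y≢y refl)
  length-remove {x} (y ∷ ys) (y∉ys ∷ u) (there x∈ys) with y ≟ x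
  ... | yes refl = ⊥-elim (All.lookup y∉ys x∈ys refl)
  ... | no _     = cong suc (length-remove ys u x∈ys)

toList-injective : (v w : Vec A n) → toList v ≡ toList w → v ≡ w
toList-injective v w e = trans (sym (Vecₚ.cast-is-id refl v)) (Vecₚ.toList-injective refl v w e)

∈-toList-lookup : (v : Vec A n) (i : Fin n) → lookup v i ∈ toList v
∈-toList-lookup v i = Vec∈.∈-toList⁺ (Vec∈.∈-lookup i v)

∈-toList⇒lookup : (v : Vec A n) {x : A} → x ∈ toList v → ∃ λ i → lookup v i ≡ x
∈-toList⇒lookup (y ∷ v) (here refl) = zero , refl
∈-toList⇒lookup (y ∷ v) (there x∈) = let (i , e) = ∈-toList⇒lookup v x∈ in suc i , e

lookup-injective : (v : Vec A n) → Unique (toList v) → ∀ {i j} → lookup v i ≡ lookup v j → i ≡ j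
lookup-injective (x ∷ v) u {zero} {zero} e = refl
lookup-injective (x ∷ v) (x∉v ∷ u) {zero} {suc j} e = ⊥-elim (All.lookup x∉v (∈-toList-lookup v j) e)
lookup-injective (x ∷ v) (x∉v ∷ u) {suc i} {zero} e = ⊥-elim (All.lookup x∉v (∈-toList-lookup v i) (sym e))
lookup-injective (x ∷ v) (x∉v ∷ u) {suc i} {suc j} e = cong suc (lookup-injective v u e)

lookup-injective⇒unique : (v : Vec A n) → (∀ {i j} → lookup v i ≡ lookup v j → i ≡ j) → Unique (toList v)
lookup-injective⇒unique [] inj = []
lookup-injective⇒unique (x ∷ v) inj =
  All.tabulate (λ y∈ x≡y → let (j , e) = ∈-toList⇒lookup v y∈ in Finₚ.0≢1+n (inj (trans x≡y (sym e))))
  ∷ lookup-injective⇒unique v (Finₚ.suc-injective ∘ inj)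

lookup-extensionality : (v w : Vec A n) → (∀ i → lookup v i ≡ lookup w i) → v ≡ w
lookup-extensionality v w h =
  trans (sym (Vecₚ.tabulate∘lookup v)) (trans (Vecₚ.tabulate-cong h) (Vecₚ.tabulate∘lookup w))

toList-surjective : (xs : List A) → length xs ≡ n → ∃ λ (v : Vec A n) → toList v ≡ xs
toList-surjective [] refl = [] , refl
toList-surjective (x ∷ xs) refl = let (v , e) = toList-surjective xs refl in x ∷ v , cong (x ∷_) e

map-lookup-allFin : (v : Vec A n) → map (lookup v) (allFin n) ≡ toList v
map-lookup-allFin v = trans (Listₚ.map-tabulate (λ i → i) (lookup v)) (tabulate-lookup v)
  where
  tabulate-lookup : (v : Vec A n) → List.tabulate (lookup v) ≡ toList v
  tabulate-lookup []      = refl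
  tabulate-lookup (x ∷ v) = cong (x ∷_) (tabulate-lookup v)

AllPairs-lookup : {R : A → A → Set} (v : Vec A n) → AllPairs R (toList v) →
  ∀ {i j} → i Fin.< j → R (lookup v i) (lookup v j)
AllPairs-lookup (x ∷ v) (x~v ∷ _) {zero} {suc j} _ = All.lookup x~v (∈-toList-lookup v j)
AllPairs-lookup (x ∷ v) (_ ∷ pv) {suc i} {suc j} (s≤s i<j) = AllPairs-lookup v pv i<j

allVecs-complete : (xs : List A) (v : Vec A k) → All (_∈ xs) (toList v) → v ∈ allVecs xs k
allVecs-complete xs [] [] = here refl
allVecs-complete xs (x ∷ v) (x∈ ∷ v⊆) =
  ∈-concatMap⁺ (λ y → map (y ∷_) (allVecs xs _)) (lose x∈ (∈-map⁺ (x ∷_) (allVecs-complete xs v v⊆)))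

allVecs-unique : (xs : List A) → Unique xs → ∀ k → Unique (allVecs xs k)
allVecs-unique xs u zero = [] ∷ []
allVecs-unique xs u (suc k) =
  unique-concatMap u (λ x → Uniqueₚ.map⁺ Vecₚ.∷-injectiveʳ (allVecs-unique xs u k)) sameHead
  where
  sameHead : ∀ {x y z} → z ∈ map (x ∷_) (allVecs xs k) → z ∈ map (y ∷_) (allVecs xs k) → x ≡ y
  sameHead z∈ z∈′ with ∈-map⁻ _ z∈ | ∈-map⁻ _ z∈′
  ... | _ , _ , refl | _ , _ , e = Vecₚ.∷-injectiveˡ e

shrubsWith : (m : ℕ) → Fin m → Fin m → List (Shrub m)
shrubsWith m r l = map (λ ρ → r , l , ρ) (allFin m)

shrubsRootedAt : (m : ℕ) → Fin m → List (Shrub m)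
shrubsRootedAt m r = concatMap (shrubsWith m r) (allFin m)

∈-shrubsWith⁻ : ∀ {r l s} → s ∈ shrubsWith m r l → ∃ λ ρ → s ≡ (r , l , ρ)
∈-shrubsWith⁻ s∈ with ∈-map⁻ _ s∈
... | ρ , _ , e = ρ , e

∈-shrubsRootedAt⁻ : ∀ {r s} → s ∈ shrubsRootedAt m r → root s ≡ r
∈-shrubsRootedAt⁻ {m} {r} s∈ with find (∈-concatMap⁻ (shrubsWith m r) {xs = allFin m} s∈)
... | _ , _ , s∈′ with ∈-shrubsWith⁻ s∈′
... | _ , refl = refl

∈-allShrubs : (s : Shrub m) → s ∈ allShrubs m
∈-allShrubs {m} (r , l , ρ) =
  ∈-concatMap⁺ (shrubsRootedAt m) (lose (∈-allFin r)
    (∈-concatMap⁺ (shrubsWith m r) (lose (∈-allFin l) (∈-map⁺ _ (∈-allFin ρ)))))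

allShrubs-unique : Unique (allShrubs m)
allShrubs-unique {m} = unique-concatMap (Uniqueₚ.allFin⁺ m)
  (λ r → unique-concatMap (Uniqueₚ.allFin⁺ m)
    (λ l → Uniqueₚ.map⁺ (cong (proj₂ ∘ proj₂)) (Uniqueₚ.allFin⁺ m)) sameLeft)
  (λ s∈ s∈′ → trans (sym (∈-shrubsRootedAt⁻ s∈)) (∈-shrubsRootedAt⁻ s∈′))
  where
  sameLeft : ∀ {r l l′ s} → s ∈ shrubsWith m r l → s ∈ shrubsWith m r l′ → l ≡ l′
  sameLeft s∈ s∈′ with ∈-shrubsWith⁻ s∈ | ∈-shrubsWith⁻ s∈′
  ... | _ , refl | _ , refl = refl

∈-allVecs-allShrubs : (F : Vec (Shrub m) k) → F ∈ allVecs (allShrubs m) k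
∈-allVecs-allShrubs F = allVecs-complete _ F (All.tabulate λ {s} _ → ∈-allShrubs s)

∈-forests⁺ : {F : Vec (Shrub (3 * n)) n} → IsForest n F → F ∈ forests n
∈-forests⁺ {F = F} = ∈-filter⁺ (isForest? _) (∈-allVecs-allShrubs F)

∈-forests⁻ : {F : Vec (Shrub (3 * n)) n} → F ∈ forests n → IsForest n F
∈-forests⁻ {n} F∈ = proj₂ (∈-filter⁻ (isForest? n) {xs = allVecs (allShrubs (3 * n)) n} F∈)

forests-unique : Unique (forests n)
forests-unique {n} = Uniqueₚ.filter⁺ (isForest? n) (allVecs-unique _ allShrubs-unique n)

∈-perms⁺ : {σ : Vec (Fin n) n} → IsPerm n σ → σ ∈ perms n
∈-perms⁺ {σ = σ} = ∈-filter⁺ (isPerm? _) (allVecs-complete _ σ (All.tabulate λ {i} _ → ∈-allFin i))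

∈-perms⁻ : {σ : Vec (Fin n) n} → σ ∈ perms n → IsPerm n σ
∈-perms⁻ {n} σ∈ = proj₂ (∈-filter⁻ (isPerm? n) {xs = allVecs (allFin n) n} σ∈)

perms-unique : Unique (perms n)
perms-unique {n} = Uniqueₚ.filter⁺ (isPerm? n) (allVecs-unique _ (Uniqueₚ.allFin⁺ n) n)

labels : List (Shrub m) → List (Fin m)
labels ss = concat (map shrubLabels ss)

labels-↭ : {ss ts : List (Shrub m)} → ss ↭ ts → labels ss ↭ labels ts
labels-↭ ↭.refl = ↭.refl
labels-↭ (↭.prep s p) = ↭ₚ.++⁺ˡ (shrubLabels s) (labels-↭ p)
labels-↭ (↭.swap s t p) = ↭.trans (↭ₚ.shifts (shrubLabels s) (shrubLabels t))
  (↭ₚ.++⁺ˡ (shrubLabels t) (↭ₚ.++⁺ˡ (shrubLabels s) (labels-↭ p)))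
labels-↭ (↭.trans p q) = ↭.trans (labels-↭ p) (labels-↭ q)

root∈labels : {s : Shrub m} {ss : List (Shrub m)} → s ∈ ss → root s ∈ labels ss
root∈labels s∈ = ∈-concat⁺′ (here refl) (∈-map⁺ shrubLabels s∈)

unique-labels⇒distinct-roots : (ss : List (Shrub m)) → Unique (labels ss) →
  AllPairs (λ s t → ¬ root s ≡ root t) ss
unique-labels⇒distinct-roots [] u = []
unique-labels⇒distinct-roots (s ∷ ss) u@(r∉ ∷ _) =
  All.tabulate (λ t∈ → All.lookup r∉ (∈-++⁺ʳ (List.drop 1 (shrubLabels s)) (root∈labels t∈)))
  ∷ unique-labels⇒distinct-roots ss (Uniqueₚ.drop⁺ 3 u)

∈-labels⇒root≤ : (ss : List (Shrub m)) → All IsShrub ss →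
  ∀ {y} → y ∈ labels ss → ∃ λ s → s ∈ ss × root s Fin.≤ y
∈-labels⇒root≤ ss shrubs y∈ with ∈-concat⁻′ (map shrubLabels ss) y∈
... | ys , y∈ys , ys∈ with ∈-map⁻ shrubLabels ys∈
... | s , s∈ , refl with y∈ys | All.lookup shrubs s∈
...   | here refl                 | _         = s , s∈ , Finₚ.≤-refl
...   | there (here refl)         | (r<l , _) = s , s∈ , ℕₚ.<⇒≤ r<l
...   | there (there (here refl)) | (_ , r<ρ) = s , s∈ , ℕₚ.<⇒≤ r<ρ

_<ᵣ_ : Shrub m → Shrub m → Set
s <ᵣ t = root s Fin.< root t

RootsIncreasing : List (Shrub m) → Set
RootsIncreasing = AllPairs _<ᵣ_

rootsIncreasing? : (ss : List (Shrub m)) → Dec (RootsIncreasing ss)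
rootsIncreasing? = AllPairs.allPairs? (λ s t → root s Fin.<? root t)

<ᵣ-irrefl : Irreflexive _≡_ (_<ᵣ_ {m})
<ᵣ-irrefl s≡t = Finₚ.<-irrefl (cong root s≡t)

-- does (a <? b) is definitionally a <ᵇ b, the test that ascents performs.
ascents-map-cong : (f g : A → ℕ) (xs : List A) → (∀ a b → (f a < f b) ⇔ (g a < g b)) →
  ascents (map f xs) ≡ ascents (map g xs)
ascents-map-cong f g [] h = refl
ascents-map-cong f g (a ∷ []) h = refl
ascents-map-cong f g (a ∷ b ∷ xs) h =
  cong₂ (λ t r → (if t then 1 else 0) + r) (does-⇔ (h a b) (f a <? f b) (g a <? g b))
    (ascents-map-cong f g (b ∷ xs) h)

rearrange : Vec (Fin n) n → Vec A n → Vec A n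
rearrange σ v = Vec.map (lookup v) σ

IsPerm⇒↭ : {σ : Vec (Fin n) n} → IsPerm n σ → toList σ ↭ allFin n
IsPerm⇒↭ {n} (u , covers) = unique∧set⇒↭ u (Uniqueₚ.allFin⁺ n)
  (λ {i} _ → ∈-allFin i) (λ {i} _ → All.lookup covers (∈-allFin i))

rearrange-↭ : {σ : Vec (Fin n) n} (v : Vec A n) → IsPerm n σ → toList (rearrange σ v) ↭ toList v
rearrange-↭ {σ = σ} v p = subst (_↭ toList v) (sym (Vecₚ.toList-map (lookup v) σ))
  (↭.trans (↭ₚ.map⁺ (lookup v) (IsPerm⇒↭ p)) (↭.↭-reflexive (map-lookup-allFin v)))

-- σ sends i to the position of v_i in w.
↭⇒rearrange : (v w : Vec A n) → Unique (toList w) → toList v ↭ toList w →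
  ∃ λ σ → IsPerm n σ × rearrange σ w ≡ v
↭⇒rearrange {n = n} v w uw v↭w = σ , (σ-unique , All.tabulate λ {k} _ → σ-covers k) , σw≡v
  where
  position : ∀ i → ∃ λ k → lookup w k ≡ lookup v i
  position i = ∈-toList⇒lookup w (↭ₚ.∈-resp-↭ v↭w (∈-toList-lookup v i))
  σ : Vec (Fin n) n
  σ = Vec.tabulate (proj₁ ∘ position)
  lookup-σ : ∀ i → lookup w (lookup σ i) ≡ lookup v i
  lookup-σ i = trans (cong (lookup w) (Vecₚ.lookup∘tabulate _ i)) (proj₂ (position i))
  σ-unique : Unique (toList σ)
  σ-unique = lookup-injective⇒unique σ λ {i} {j} e →
    lookup-injective v (unique-resp-↭ (↭-sym v↭w) uw)
      (trans (sym (lookup-σ i)) (trans (cong (lookup w) e) (lookup-σ j)))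
  σ-covers : ∀ k → k ∈ toList σ
  σ-covers k with ∈-toList⇒lookup v (↭ₚ.∈-resp-↭ (↭-sym v↭w) (∈-toList-lookup w k))
  ... | i , e = subst (_∈ toList σ) (lookup-injective w uw (trans (lookup-σ i) e)) (∈-toList-lookup σ i)
  σw≡v : rearrange σ w ≡ v
  σw≡v = lookup-extensionality _ v λ i → trans (Vecₚ.lookup-map i (lookup w) σ) (lookup-σ i)

rearrange-injectiveˡ : {σ τ : Vec (Fin n) n} (v : Vec A n) → Unique (toList v) →
  rearrange σ v ≡ rearrange τ v → σ ≡ τ
rearrange-injectiveˡ {σ = σ} {τ} v uv e = lookup-extensionality σ τ λ i →
  lookup-injective v uv (trans (sym (Vecₚ.lookup-map i (lookup v) σ))
    (trans (cong (λ u → lookup u i) e) (Vecₚ.lookup-map i (lookup v) τ)))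

Forest : ℕ → Set
Forest n = Vec (Shrub (3 * n)) n

IsIncreasingForest : (n : ℕ) → Forest n → Set
IsIncreasingForest n G = IsForest n G × RootsIncreasing (toList G)

increasingForests : (n : ℕ) → List (Forest n)
increasingForests n =
  filter (λ G → isForest? n G ×-dec rootsIncreasing? (toList G)) (allVecs (allShrubs (3 * n)) n)

IsForest-resp-↭ : {F G : Forest n} → toList F ↭ toList G → IsForest n F → IsForest n G
IsForest-resp-↭ p (shrubs , u , covers) =
  ↭ₚ.All-resp-↭ p shrubs , unique-resp-↭ (labels-↭ p) u , All.map (↭ₚ.∈-resp-↭ (labels-↭ p)) covers

IsForest⇒unique : {F : Forest n} → IsForest n F → Unique (toList F)
IsForest⇒unique (_ , u , _) =
  AllPairs.map (λ r≢r′ s≡t → r≢r′ (cong root s≡t)) (unique-labels⇒distinct-roots _ u)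

sortForest : {F : Forest n} → IsForest n F → ∃ λ G → IsIncreasingForest n G × toList G ↭ toList F
sortForest {n} {F} forest = G , (forestG , increasing) , G↭F
  where
  module S = Sort (On.decTotalOrder (Finₚ.≤-decTotalOrder (3 * n)) root)
  sorted : ∃ λ (G : Forest n) → toList G ≡ S.sort (toList F)
  sorted = toList-surjective _ (trans (↭ₚ.↭-length (S.sort-↭ (toList F))) (Vecₚ.length-toList F))
  G = proj₁ sorted
  G↭F : toList G ↭ toList F
  G↭F = subst (_↭ toList F) (sym (proj₂ sorted)) (S.sort-↭ (toList F))
  forestG : IsForest n G
  forestG = IsForest-resp-↭ (↭-sym G↭F) forest
  increasing : RootsIncreasing (toList G)
  increasing = AllPairs.zipWith (λ (r≤r′ , r≢r′) → Finₚ.≤∧≢⇒< r≤r′ r≢r′)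
    ( subst (AllPairs _) (sym (proj₂ sorted)) (Linkedₚ.Linked⇒AllPairs Finₚ.≤-trans (S.sort-↗ (toList F)))
    , unique-labels⇒distinct-roots (toList G) (proj₁ (proj₂ forestG)))

lookup-<ᵣ⇒< : (G : Vec (Shrub m) n) → RootsIncreasing (toList G) →
  ∀ {i j} → lookup G i <ᵣ lookup G j → i Fin.< j
lookup-<ᵣ⇒< G increasing {i} {j} r<r′ with Finₚ.<-cmp i j
... | tri< i<j _ _ = i<j
... | tri≈ _ refl _ = ⊥-elim (Finₚ.<-irrefl refl r<r′)
... | tri> _ _ j<i = ⊥-elim (Finₚ.<-asym r<r′ (AllPairs-lookup G increasing j<i))

risB-rearrange : (σ : Vec (Fin n) n) (G : Vec (Shrub m) n) → RootsIncreasing (toList G) →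
  risB (rearrange σ G) ≡ ris σ
risB-rearrange σ G increasing = begin
    ascents (map (toℕ ∘ root) (toList (rearrange σ G)))
  ≡⟨ cong (ascents ∘ map (toℕ ∘ root)) (Vecₚ.toList-map (lookup G) σ) ⟩
    ascents (map (toℕ ∘ root) (map (lookup G) (toList σ)))
  ≡⟨ cong ascents (Listₚ.map-∘ (toList σ)) ⟨
    ascents (map (toℕ ∘ root ∘ lookup G) (toList σ))
  ≡⟨ ascents-map-cong _ toℕ (toList σ)
       (λ i j → mk⇔ (lookup-<ᵣ⇒< G increasing) (AllPairs-lookup G increasing)) ⟩
    ris σ ∎
  where open ≡-Reasoning

module _ (n : ℕ) where

  private
    pairs : List (Vec (Fin n) n × Forest n)
    pairs = cartesianProduct (perms n) (increasingForests n)

    ∈-increasingForests⁺ : {G : Forest n} → IsIncreasingForest n G → G ∈ increasingForests n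
    ∈-increasingForests⁺ {G} = ∈-filter⁺ _ (∈-allVecs-allShrubs G)

    ∈-increasingForests⁻ : {G : Forest n} → G ∈ increasingForests n → IsIncreasingForest n G
    ∈-increasingForests⁻ G∈ = proj₂ (∈-filter⁻ _ {xs = allVecs (allShrubs (3 * n)) n} G∈)

    ∈-pairs⁻ : ∀ {σ G} → (σ , G) ∈ pairs → IsPerm n σ × IsIncreasingForest n G
    ∈-pairs⁻ p∈ with ∈-cartesianProduct⁻ (perms n) (increasingForests n) p∈
    ... | σ∈ , G∈ = ∈-perms⁻ σ∈ , ∈-increasingForests⁻ G∈

    rearrange-injectiveOn : ∀ {p q} → p ∈ pairs → q ∈ pairs →
      rearrange (proj₁ p) (proj₂ p) ≡ rearrange (proj₁ q) (proj₂ q) → p ≡ q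
    rearrange-injectiveOn {σ , G} {τ , H} p∈ q∈ e with ∈-pairs⁻ p∈ | ∈-pairs⁻ q∈
    ... | σ-perm , forestG , incG | τ-perm , forestH , incH = cong₂ _,_ σ≡τ G≡H
      where
      G↭H : toList G ↭ toList H
      G↭H = ↭.trans (↭-sym (rearrange-↭ G σ-perm))
        (subst (λ v → toList v ↭ toList H) (sym e) (rearrange-↭ H τ-perm))
      G≡H : G ≡ H
      G≡H = toList-injective G H (strictlySorted-unique <ᵣ-irrefl Finₚ.<-asym incG incH
        (↭ₚ.∈-resp-↭ G↭H) (↭ₚ.∈-resp-↭ (↭-sym G↭H)))
      σ≡τ : σ ≡ τ
      σ≡τ = rearrange-injectiveˡ G (IsForest⇒unique forestG)
        (trans e (cong (rearrange τ) (sym G≡H)))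

    rearrange-surjective : ∀ {F} → F ∈ forests n →
      ∃ λ p → p ∈ pairs × rearrange (proj₁ p) (proj₂ p) ≡ F
    rearrange-surjective F∈ with sortForest (∈-forests⁻ F∈)
    ... | G , increasingG@(forestG , _) , G↭F with ↭⇒rearrange _ G (IsForest⇒unique forestG) (↭-sym G↭F)
    ... | σ , σ-perm , σG≡F =
      (σ , G) , ∈-cartesianProduct⁺ (∈-perms⁺ σ-perm) (∈-increasingForests⁺ increasingG) , σG≡F

    rearrange-↭-forests : map (λ p → rearrange (proj₁ p) (proj₂ p)) pairs ↭ forests n
    rearrange-↭-forests = map-bijectiveOn⇒↭
      (Uniqueₚ.cartesianProduct⁺ perms-unique
        (Uniqueₚ.filter⁺ _ (allVecs-unique _ allShrubs-unique n)))
      forests-unique rearrange-injectiveOn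
      (λ p∈ → let (σ-perm , forestG , _) = ∈-pairs⁻ p∈ in
        ∈-forests⁺ (IsForest-resp-↭ (↭-sym (rearrange-↭ _ σ-perm)) forestG))
      rearrange-surjective

  sum-forests-risB : (x : ℕ) →
    sum (map (λ F → x ^ risB F) (forests n))
      ≡ length (increasingForests n) * sum (map (λ σ → x ^ ris σ) (perms n))
  sum-forests-risB x = begin
      sum (map (λ F → x ^ risB F) (forests n))
    ≡⟨ sum-↭ (↭ₚ.map⁺ _ (↭-sym rearrange-↭-forests)) ⟩
      sum (map (λ F → x ^ risB F) (map (λ p → rearrange (proj₁ p) (proj₂ p)) pairs))
    ≡⟨ cong sum (Listₚ.map-∘ pairs) ⟨
      sum (map (λ p → x ^ risB (rearrange (proj₁ p) (proj₂ p))) pairs)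
    ≡⟨ cong sum (Listₚ.map-cong-local {xs = pairs} (All.tabulate λ {(σ , G)} p∈ →
         cong (x ^_) (risB-rearrange σ G (proj₂ (proj₂ (∈-pairs⁻ p∈)))))) ⟩
      sum (map ((λ σ → x ^ ris σ) ∘ proj₁) pairs)
    ≡⟨ sum-cartesianProduct (λ σ → x ^ ris σ) (perms n) (increasingForests n) ⟩
      length (increasingForests n) * sum (map (λ σ → x ^ ris σ) (perms n)) ∎
    where open ≡-Reasoning

increasingForestCount : ℕ → ℕ
increasingForestCount zero    = 1
increasingForestCount (suc k) = (2 + 3 * k) * (1 + 3 * k) * increasingForestCount k

module _ {m : ℕ} where

  open DecidableLists (_≟_ {m})
  open DecMembership (_≟_ {m}) using (_∈?_)

  IsIncreasingForestOn : List (Fin m) → Vec (Shrub m) k → Set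
  IsIncreasingForestOn S G = All IsShrub (toList G) × Unique (labels (toList G))
    × All (_∈ S) (labels (toList G)) × All (_∈ labels (toList G)) S × RootsIncreasing (toList G)

  isIncreasingForestOn? : (S : List (Fin m)) (G : Vec (Shrub m) k) → Dec (IsIncreasingForestOn S G)
  isIncreasingForestOn? S G = all? isShrub? (toList G) ×-dec UniqueDec.unique? _≟_ (labels (toList G))
    ×-dec all? (_∈? S) (labels (toList G)) ×-dec all? (_∈? labels (toList G)) S
    ×-dec rootsIncreasing? (toList G)

  IsMinimum : List (Fin m) → Fin m → Set
  IsMinimum S r = r ∈ S × All (r Fin.≤_) S

  isMinimum? : (S : List (Fin m)) (r : Fin m) → Dec (IsMinimum S r)
  isMinimum? S r = (r ∈? S) ×-dec all? (r Finₚ.≤?_) S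

  IsFirstShrubOn : List (Fin m) → Shrub m → Set
  IsFirstShrubOn S (r , l , ρ) = IsMinimum S r × l ∈ remove r S × ρ ∈ remove l (remove r S)

  isFirstShrubOn? : (S : List (Fin m)) (s : Shrub m) → Dec (IsFirstShrubOn S s)
  isFirstShrubOn? S (r , l , ρ) = isMinimum? S r ×-dec (l ∈? remove r S) ×-dec (ρ ∈? remove l (remove r S))

  remainingLabels : List (Fin m) → Shrub m → List (Fin m)
  remainingLabels S (r , l , ρ) = remove ρ (remove l (remove r S))

  ∈-remainingLabels⁻ : ∀ {S r l ρ y} → y ∈ remainingLabels S (r , l , ρ) →
    y ∈ S × ¬ y ≡ r × ¬ y ≡ l × ¬ y ≡ ρ
  ∈-remainingLabels⁻ y∈ with ∈-remove⁻ y∈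
  ... | y∈′ , y≢ρ with ∈-remove⁻ y∈′
  ... | y∈″ , y≢l with ∈-remove⁻ y∈″
  ... | y∈S , y≢r = y∈S , y≢r , y≢l , y≢ρ

  ∈-remainingLabels⁺ : ∀ {S r l ρ y} → y ∈ S → ¬ y ≡ r → ¬ y ≡ l → ¬ y ≡ ρ →
    y ∈ remainingLabels S (r , l , ρ)
  ∈-remainingLabels⁺ y∈S y≢r y≢l y≢ρ = ∈-remove⁺ (∈-remove⁺ (∈-remove⁺ y∈S y≢r) y≢l) y≢ρ

  IsFirstShrubOn⁻ : ∀ {S r l ρ} → IsFirstShrubOn S (r , l , ρ) →
    l ∈ S × ρ ∈ S × ¬ l ≡ r × ¬ ρ ≡ r × ¬ ρ ≡ l
  IsFirstShrubOn⁻ (_ , l∈ , ρ∈) with ∈-remove⁻ l∈ | ∈-remove⁻ ρ∈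
  ... | l∈S , l≢r | ρ∈′ , ρ≢l with ∈-remove⁻ ρ∈′
  ... | ρ∈S , ρ≢r = l∈S , ρ∈S , l≢r , ρ≢r , ρ≢l

  length-remainingLabels : ∀ {S} (s : Shrub m) → Unique S → IsFirstShrubOn S s →
    3 + length (remainingLabels S s) ≡ length S
  length-remainingLabels {S} (r , l , ρ) u ((r∈S , _) , l∈ , ρ∈) =
    trans (cong (2 +_) (length-remove (remove l (remove r S)) (remove-unique (remove-unique u)) ρ∈))
      (trans (cong (1 +_) (length-remove (remove r S) (remove-unique u) l∈)) (length-remove S u r∈S))

  remainingLabels-unique : ∀ {S} (s : Shrub m) → Unique S → Unique (remainingLabels S s)
  remainingLabels-unique s u = remove-unique (remove-unique (remove-unique u))

  IsIncreasingForestOn-∷⁻ : ∀ {S} (s : Shrub m) (G : Vec (Shrub m) k) → IsIncreasingForestOn S (s ∷ G) →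
    IsFirstShrubOn S s × IsIncreasingForestOn (remainingLabels S s) G
  IsIncreasingForestOn-∷⁻ {S = S} (r , l , ρ) G
    ((r<l , r<ρ) ∷ shrubs , (r∉ ∷ l∉ ∷ ρ∉ ∷ u) , (r∈S ∷ l∈S ∷ ρ∈S ∷ G⊆S) , covers , (r<G ∷ increasing)) =
      ( (r∈S , All.tabulate r≤)
      , ∈-remove⁺ l∈S (≢r (here refl))
      , ∈-remove⁺ (∈-remove⁺ ρ∈S (≢r (there (here refl)))) (≢l (here refl)) )
    , shrubs , u
    , All.tabulate (λ y∈ → ∈-remainingLabels⁺ (All.lookup G⊆S y∈)
        (≢r (there (there y∈))) (≢l (there y∈)) (≢ρ y∈))
    , All.tabulate remaining⊆G
    , increasing
    where
    ≢r : ∀ {y} → y ∈ l ∷ ρ ∷ labels (toList G) → ¬ y ≡ r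
    ≢r = ≢-sym ∘ All.lookup r∉
    ≢l : ∀ {y} → y ∈ ρ ∷ labels (toList G) → ¬ y ≡ l
    ≢l = ≢-sym ∘ All.lookup l∉
    ≢ρ : ∀ {y} → y ∈ labels (toList G) → ¬ y ≡ ρ
    ≢ρ = ≢-sym ∘ All.lookup ρ∉
    r≤ : ∀ {y} → y ∈ S → r Fin.≤ y
    r≤ y∈ with All.lookup covers y∈
    ... | here refl = Finₚ.≤-refl
    ... | there (here refl) = ℕₚ.<⇒≤ r<l
    ... | there (there (here refl)) = ℕₚ.<⇒≤ r<ρ
    ... | there (there (there y∈G)) with ∈-labels⇒root≤ (toList G) shrubs y∈G
    ...   | t , t∈ , t≤y = ℕₚ.<⇒≤ (ℕₚ.<-≤-trans (All.lookup r<G t∈) t≤y)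
    remaining⊆G : ∀ {y} → y ∈ remainingLabels S (r , l , ρ) → y ∈ labels (toList G)
    remaining⊆G y∈ with ∈-remainingLabels⁻ y∈
    ... | y∈S , y≢r , y≢l , y≢ρ with All.lookup covers y∈S
    ... | here y≡r = ⊥-elim (y≢r y≡r)
    ... | there (here y≡l) = ⊥-elim (y≢l y≡l)
    ... | there (there (here y≡ρ)) = ⊥-elim (y≢ρ y≡ρ)
    ... | there (there (there y∈G)) = y∈G

  IsIncreasingForestOn-∷⁺ : ∀ {S} (s : Shrub m) (G : Vec (Shrub m) k) → IsFirstShrubOn S s →
    IsIncreasingForestOn (remainingLabels S s) G → IsIncreasingForestOn S (s ∷ G)
  IsIncreasingForestOn-∷⁺ {S = S} (r , l , ρ) G first@((r∈S , r≤S) , _)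
    (shrubs , u , G⊆remaining , remaining⊆G , increasing) with IsFirstShrubOn⁻ first
  ... | l∈S , ρ∈S , l≢r , ρ≢r , ρ≢l =
      (above-r l∈S l≢r , above-r ρ∈S ρ≢r) ∷ shrubs
    , ( All.tabulate (≢-sym ∘ r∉) ∷ All.tabulate (≢-sym ∘ l∉) ∷ All.tabulate (≢-sym ∘ ρ∉) ∷ u )
    , r∈S ∷ l∈S ∷ ρ∈S ∷ All.map (proj₁ ∘ ∈-remainingLabels⁻) G⊆remaining
    , All.tabulate covers
    , All.tabulate (λ t∈ → let (t∈S , t≢r , _) = remaining (root∈labels t∈) in above-r t∈S t≢r)
      ∷ increasing
    where
    above-r : ∀ {y} → y ∈ S → ¬ y ≡ r → r Fin.< y
    above-r y∈S y≢r = Finₚ.≤∧≢⇒< (All.lookup r≤S y∈S) (≢-sym y≢r)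
    remaining : ∀ {y} → y ∈ labels (toList G) → y ∈ S × ¬ y ≡ r × ¬ y ≡ l × ¬ y ≡ ρ
    remaining y∈ = ∈-remainingLabels⁻ (All.lookup G⊆remaining y∈)
    r∉ : ∀ {y} → y ∈ l ∷ ρ ∷ labels (toList G) → ¬ y ≡ r
    r∉ (here refl) = l≢r
    r∉ (there (here refl)) = ρ≢r
    r∉ (there (there y∈)) = proj₁ (proj₂ (remaining y∈))
    l∉ : ∀ {y} → y ∈ ρ ∷ labels (toList G) → ¬ y ≡ l
    l∉ (here refl) = ρ≢l
    l∉ (there y∈) = proj₁ (proj₂ (proj₂ (remaining y∈)))
    ρ∉ : ∀ {y} → y ∈ labels (toList G) → ¬ y ≡ ρ
    ρ∉ y∈ = proj₂ (proj₂ (proj₂ (remaining y∈)))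
    covers : ∀ {y} → y ∈ S → y ∈ r ∷ l ∷ ρ ∷ labels (toList G)
    covers {y} y∈S with y ≟ r | y ≟ l | y ≟ ρ
    ... | yes refl | _        | _        = here refl
    ... | no _     | yes refl | _        = there (here refl)
    ... | no _     | no _     | yes refl = there (there (here refl))
    ... | no y≢r   | no y≢l   | no y≢ρ   =
      there (there (there (All.lookup remaining⊆G (∈-remainingLabels⁺ y∈S y≢r y≢l y≢ρ))))

  minimum-exists : (x : Fin m) (S : List (Fin m)) → ∃ (IsMinimum (x ∷ S))
  minimum-exists x [] = x , here refl , Finₚ.≤-refl ∷ []
  minimum-exists x (y ∷ S) with minimum-exists y S
  ... | r , r∈ , r≤ with x Finₚ.≤? r
  ...   | yes x≤r = x , here refl , Finₚ.≤-refl ∷ All.map (Finₚ.≤-trans x≤r) r≤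
  ...   | no x≰r  = r , there r∈ , ℕₚ.<⇒≤ (ℕₚ.≰⇒> x≰r) ∷ r≤

  minimum-unique : ∀ {S r r′} → IsMinimum S r → IsMinimum S r′ → r ≡ r′
  minimum-unique (r∈ , r≤) (r′∈ , r′≤) = Finₚ.≤-antisym (All.lookup r≤ r′∈) (All.lookup r′≤ r∈)

  count-isMinimum : (x : Fin m) (S : List (Fin m)) → count (isMinimum? (x ∷ S)) (allFin m) ≡ 1
  count-isMinimum x S with minimum-exists x S
  ... | r , r-min = trans
    (count-cong (isMinimum? (x ∷ S)) (_∈? (r ∷ [])) (allFin m)
      (λ _ r′-min → here (minimum-unique r′-min r-min)) (λ { _ (here refl) → r-min }))
    (count-∈ ([] ∷ []) (Uniqueₚ.allFin⁺ m) (λ _ → ∈-allFin _))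

  count-shrubsWith : ∀ {S r} l j → IsMinimum S r → Unique S → length (remove r S) ≡ 2 + j →
    count (isFirstShrubOn? S) (shrubsWith m r l) ≡ 𝟙 (l ∈? remove r S) * (1 + j)
  count-shrubsWith {S} {r} l j r-min u |S-r| with l ∈? remove r S
  ... | no l∉ = count-none (isFirstShrubOn? S) _ λ s∈ first → case-left s∈ first
    where
    case-left : ∀ {s} → s ∈ shrubsWith m r l → ¬ IsFirstShrubOn S s
    case-left s∈ with ∈-shrubsWith⁻ s∈
    ... | _ , refl = l∉ ∘ proj₁ ∘ proj₂
  ... | yes l∈ = begin
      count (isFirstShrubOn? S) (map (λ ρ → r , l , ρ) (allFin m))
    ≡⟨ count-map (isFirstShrubOn? S) (λ ρ → r , l , ρ) (allFin m) ⟩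
      count (λ ρ → isFirstShrubOn? S (r , l , ρ)) (allFin m)
    ≡⟨ count-cong _ (_∈? remove l (remove r S)) (allFin m) (λ _ → proj₂ ∘ proj₂) (λ _ ρ∈ → r-min , l∈ , ρ∈) ⟩
      count (_∈? remove l (remove r S)) (allFin m)
    ≡⟨ count-∈ (remove-unique (remove-unique u)) (Uniqueₚ.allFin⁺ m) (λ _ → ∈-allFin _) ⟩
      length (remove l (remove r S))
    ≡⟨ ℕₚ.suc-injective (trans (length-remove (remove r S) (remove-unique u) l∈) |S-r|) ⟩
      1 + j
    ≡⟨ ℕₚ.*-identityˡ (1 + j) ⟨
      1 * (1 + j) ∎
    where open ≡-Reasoning

  count-shrubsRootedAt : ∀ {S} r j → Unique S → length S ≡ 3 + j →
    count (isFirstShrubOn? S) (shrubsRootedAt m r) ≡ 𝟙 (isMinimum? S r) * ((2 + j) * (1 + j))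
  count-shrubsRootedAt {S} r j u |S| with isMinimum? S r
  ... | no ¬r-min = count-none (isFirstShrubOn? S) _ λ s∈ first → case-root s∈ first
    where
    case-root : ∀ {s} → s ∈ shrubsRootedAt m r → ¬ IsFirstShrubOn S s
    case-root {_ , _ , _} s∈ (s-min , _) = ¬r-min (subst (IsMinimum S) (∈-shrubsRootedAt⁻ s∈) s-min)
  ... | yes r-min = begin
      count (isFirstShrubOn? S) (concatMap (shrubsWith m r) (allFin m))
    ≡⟨ count-concatMap _ (_∈? remove r S) (shrubsWith m r) (1 + j) (allFin m)
         (λ {l} _ → count-shrubsWith l j r-min u |S-r|) ⟩
      count (_∈? remove r S) (allFin m) * (1 + j)
    ≡⟨ cong (_* (1 + j)) (count-∈ (remove-unique u) (Uniqueₚ.allFin⁺ m) (λ _ → ∈-allFin _)) ⟩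
      length (remove r S) * (1 + j)
    ≡⟨ cong (_* (1 + j)) |S-r| ⟩
      (2 + j) * (1 + j)
    ≡⟨ ℕₚ.*-identityˡ _ ⟨
      1 * ((2 + j) * (1 + j)) ∎
    where
    open ≡-Reasoning
    |S-r| : length (remove r S) ≡ 2 + j
    |S-r| = ℕₚ.suc-injective (trans (length-remove S u (proj₁ r-min)) |S|)

  count-firstShrubs : ∀ {S} j → Unique S → length S ≡ 3 + j →
    count (isFirstShrubOn? S) (allShrubs m) ≡ (2 + j) * (1 + j)
  count-firstShrubs {x ∷ S} j u |S| = begin
      count (isFirstShrubOn? (x ∷ S)) (concatMap (shrubsRootedAt m) (allFin m))
    ≡⟨ count-concatMap _ (isMinimum? (x ∷ S)) (shrubsRootedAt m) _ (allFin m)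
         (λ {r} _ → count-shrubsRootedAt r j u |S|) ⟩
      count (isMinimum? (x ∷ S)) (allFin m) * ((2 + j) * (1 + j))
    ≡⟨ cong (_* _) (count-isMinimum x S) ⟩
      1 * ((2 + j) * (1 + j))
    ≡⟨ ℕₚ.*-identityˡ _ ⟩
      (2 + j) * (1 + j) ∎
    where open ≡-Reasoning

  count-increasingForestsOn : ∀ k {S} → Unique S → length S ≡ 3 * k →
    count (isIncreasingForestOn? S) (allVecs (allShrubs m) k) ≡ increasingForestCount k
  count-increasingForestsOn zero {[]} u refl with isIncreasingForestOn? {k = 0} [] []
  ... | yes _      = refl
  ... | no ¬forest = ⊥-elim (¬forest ([] , [] , [] , [] , []))
  count-increasingForestsOn (suc k) {S} u |S| = begin
      count (isIncreasingForestOn? S) (concatMap (λ s → map (s ∷_) (allVecs (allShrubs m) k)) (allShrubs m))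
    ≡⟨ count-concatMap _ (isFirstShrubOn? S) (λ s → map (s ∷_) (allVecs (allShrubs m) k)) _ (allShrubs m)
         (λ {s} _ → trans (count-map _ (s ∷_) (allVecs (allShrubs m) k)) (forestsStartingWith s)) ⟩
      count (isFirstShrubOn? S) (allShrubs m) * increasingForestCount k
    ≡⟨ cong (_* increasingForestCount k) (count-firstShrubs (3 * k) u |S|′) ⟩
      increasingForestCount (suc k) ∎
    where
    open ≡-Reasoning
    |S|′ : length S ≡ 3 + 3 * k
    |S|′ = trans |S| (ℕₚ.*-suc 3 k)
    forestsStartingWith : ∀ s → count (λ G → isIncreasingForestOn? S (s ∷ G)) (allVecs (allShrubs m) k)
      ≡ 𝟙 (isFirstShrubOn? S s) * increasingForestCount k
    forestsStartingWith s with isFirstShrubOn? S s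
    ... | no ¬first = count-none _ (allVecs (allShrubs m) k) λ {G} _ → ¬first ∘ proj₁ ∘ IsIncreasingForestOn-∷⁻ s G
    ... | yes first = begin
        count (λ G → isIncreasingForestOn? S (s ∷ G)) (allVecs (allShrubs m) k)
      ≡⟨ count-cong _ (isIncreasingForestOn? (remainingLabels S s)) (allVecs (allShrubs m) k)
           (λ {G} _ → proj₂ ∘ IsIncreasingForestOn-∷⁻ s G) (λ {G} _ → IsIncreasingForestOn-∷⁺ s G first) ⟩
        count (isIncreasingForestOn? (remainingLabels S s)) (allVecs (allShrubs m) k)
      ≡⟨ count-increasingForestsOn k (remainingLabels-unique s u)
           (ℕₚ.+-cancelˡ-≡ 3 _ _ (trans (length-remainingLabels s u first) |S|′)) ⟩
        increasingForestCount k
      ≡⟨ ℕₚ.*-identityˡ _ ⟨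
        1 * increasingForestCount k ∎

length-increasingForests : (n : ℕ) → length (increasingForests n) ≡ increasingForestCount n
length-increasingForests n = trans
  (count-cong _ (isIncreasingForestOn? (allFin (3 * n))) (allVecs (allShrubs (3 * n)) n)
    (λ _ ((shrubs , u , covers) , increasing) →
      shrubs , u , All.tabulate (λ _ → ∈-allFin _) , covers , increasing)
    (λ _ (shrubs , u , _ , covers , increasing) → (shrubs , u , covers) , increasing))
  (count-increasingForestsOn n (Uniqueₚ.allFin⁺ (3 * n)) (Listₚ.length-tabulate (λ i → i)))

increasingForestCount-closedForm : ∀ k → increasingForestCount k * (3 ^ k * k !) ≡ (3 * k) !
increasingForestCount-closedForm zero = refl
increasingForestCount-closedForm (suc k) = begin
    (2 + 3 * k) * (1 + 3 * k) * increasingForestCount k * (3 * 3 ^ k * (suc k * k !))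
  ≡⟨ regroup (increasingForestCount k) (3 ^ k) (k !) k ⟩
    (3 + 3 * k) * ((2 + 3 * k) * ((1 + 3 * k) * (increasingForestCount k * (3 ^ k * k !))))
  ≡⟨ cong (λ c → (3 + 3 * k) * ((2 + 3 * k) * ((1 + 3 * k) * c))) (increasingForestCount-closedForm k) ⟩
    (3 + 3 * k) !
  ≡⟨ cong _! (ℕₚ.*-suc 3 k) ⟨
    (3 * suc k) ! ∎
  where
  open ≡-Reasoning
  regroup : ∀ c p f k → (2 + 3 * k) * (1 + 3 * k) * c * (3 * p * (suc k * f))
    ≡ (3 + 3 * k) * ((2 + 3 * k) * ((1 + 3 * k) * (c * (p * f))))
  regroup = solve-∀

mainTheorem8 : (n : ℕ) → 1 ≤ n → (x : ℕ) →
    3 ^ n * n ! * sum (map (λ F → x ^ risB F) (forests n))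
      ≡ (3 * n) ! * sum (map (λ σ → x ^ ris σ) (perms n))
mainTheorem8 n _ x = begin
    3 ^ n * n ! * sum (map (λ F → x ^ risB F) (forests n))
  ≡⟨ cong (3 ^ n * n ! *_) (sum-forests-risB n x) ⟩
    3 ^ n * n ! * (length (increasingForests n) * Σris)
  ≡⟨ cong (λ c → 3 ^ n * n ! * (c * Σris)) (length-increasingForests n) ⟩
    3 ^ n * n ! * (increasingForestCount n * Σris)
  ≡⟨ ℕₚ.*-assoc (3 ^ n * n !) _ Σris ⟨
    3 ^ n * n ! * increasingForestCount n * Σris
  ≡⟨ cong (_* Σris) (ℕₚ.*-comm (3 ^ n * n !) _) ⟩
    increasingForestCount n * (3 ^ n * n !) * Σris
  ≡⟨ cong (_* Σris) (increasingForestCount-closedForm n) ⟩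
    (3 * n) ! * Σris ∎
  where
  open ≡-Reasoning
  Σris : ℕ
  Σris = sum (map (λ σ → x ^ ris σ) (perms n))
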